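{- If $G$ is a connected graph with $\operatorname{diam}(G)=2$, then $\mathrm{gp}_{\rm o}(G)=\alpha(G^{ - }_{\rm tt})$. In particular, if $G$ has no true twins, then $\mathrm{gp}_{\rm o}(G)=\alpha(G)$.
   Context: All graphs are finite and simple. For $X\subseteq V(G)$, two vertices $u,v$ are $X$-positionable if no shortest $u,v$-path in $G$ has an internal vertex in $X$. $X$ is an outer general position set if every two vertices of $X$ are $X$-positionable and every $u\in X$, $v\in V(G)\setminus X$ are $X$-positionable; $\mathrm{gp}_{\rm o}(G)$ is the maximum cardinality of an outer general position set of $G$. Vertices $u,v$ are true twins if $N_G[u]=N_G[v]$ (closed neighbourhoods). $G^{ - }_{\rm tt}$ denotes the graph obtained from $G$ by removing the edge between each pair of true twins. $\alpha$ denotes the independence number. -}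

module Defs where

open import Level using (0ℓ)
open import Data.Nat using (ℕ; zero; suc; _≤_)
open import Data.Fin using (Fin)
open import Data.Fin.Subset using (Subset; _∈_; _∉_; ∣_∣)
open import Data.Product using (Σ; ∃; ∃-syntax; _×_; _,_; proj₁; proj₂)
open import Data.Sum using (_⊎_; inj₁; inj₂)
open import Data.Empty using (⊥)
open import Relation.Nullary using (¬_)
open import Relation.Binary.PropositionalEquality using (_≡_; _≢_; refl; sym)
open import Function.Bundles using (_⇔_; mk⇔; Equivalence)

record Graph (n : ℕ) : Set₁ where
  field
    Adj     : Fin n → Fin n → Set
    Adj-sym : ∀ {u v} → Adj u v → Adj v u
    Adj-irr : ∀ {u} → ¬ Adj u u

module _ {n : ℕ} (G : Graph n) where
  open Graph G

  data Walk : Fin n → Fin n → Set where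
    nil  : ∀ {u} → Walk u u
    cons : ∀ {u w v} → Adj u w → Walk w v → Walk u v

  len : ∀ {u v} → Walk u v → ℕ
  len nil        = zero
  len (cons _ p) = suc (len p)

  -- Internal vertices of a walk (all vertices except first and last position).
  data Interior : ∀ {u v} → Walk u v → Fin n → Set where
    here  : ∀ {u w x v} {e : Adj u w} {e' : Adj w x} {q : Walk x v} →
            Interior (cons e (cons e' q)) w
    there : ∀ {u w v y} {e : Adj u w} {q : Walk w v} →
            Interior q y → Interior (cons e q) y

  -- A shortest u,v-path: a u,v-walk of minimum length (such a walk is a path).
  IsShortest : ∀ {u v} → Walk u v → Set
  IsShortest {u} {v} p = ∀ (q : Walk u v) → len p ≤ len q

  Dist : Fin n → Fin n → ℕ → Set
  Dist u v k = Σ (Walk u v) λ p → IsShortest p × len p ≡ k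

  Connected : Set
  Connected = ∀ u v → Walk u v

  HasDiameter : ℕ → Set
  HasDiameter d = (∀ u v → ∃[ k ] (Dist u v k × k ≤ d)) × (∃[ u ] ∃[ v ] Dist u v d)

  Positionable : Subset n → Fin n → Fin n → Set
  Positionable X u v =
    ∀ (p : Walk u v) → IsShortest p → ∀ x → Interior p x → x ∉ X

  IsOuterGP : Subset n → Set
  IsOuterGP X =
    (∀ u v → u ∈ X → v ∈ X → u ≢ v → Positionable X u v) ×
    (∀ u v → u ∈ X → v ∉ X → Positionable X u v)

  IsGpo : ℕ → Set
  IsGpo k = (∃[ X ] (IsOuterGP X × ∣ X ∣ ≡ k)) ×
            (∀ X → IsOuterGP X → ∣ X ∣ ≤ k)

  IsIndependent : Subset n → Set
  IsIndependent X = ∀ u v → u ∈ X → v ∈ X → ¬ Adj u v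

  IsAlpha : ℕ → Set
  IsAlpha k = (∃[ X ] (IsIndependent X × ∣ X ∣ ≡ k)) ×
              (∀ X → IsIndependent X → ∣ X ∣ ≤ k)

  ClosedNbr : Fin n → Fin n → Set
  ClosedNbr u x = x ≡ u ⊎ Adj u x

  TrueTwins : Fin n → Fin n → Set
  TrueTwins u v = u ≢ v × (∀ x → ClosedNbr u x ⇔ ClosedNbr v x)

  TrueTwins-sym : ∀ {u v} → TrueTwins u v → TrueTwins v u
  TrueTwins-sym (u≢v , f) =
    (λ e → u≢v (sym e)) ,
    (λ x → mk⇔ (Equivalence.from (f x)) (Equivalence.to (f x)))

  NoTrueTwins : Set
  NoTrueTwins = ∀ u v → ¬ TrueTwins u v

G⁻tt : ∀ {n} → Graph n → Graph n
G⁻tt G = record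
  { Adj     = λ u v → Adj u v × ¬ TrueTwins G u v
  ; Adj-sym = λ { (a , t) → Adj-sym a , (λ tw → t (TrueTwins-sym G tw)) }
  ; Adj-irr = λ { (a , _) → Adj-irr a }
  }
  where open Graph G

-- Two adjacent members u, v of an outer general position set are true twins:
-- a neighbour x of u that is not in N[v] would make v u x a shortest path with
-- the member u inside. Conversely, when the diameter is at most 2, an interior
-- vertex x of a shortest path from a member u is a neighbour of u and of the
-- far end v; if x were a member, independence in G⁻tt would make u, x true
-- twins, putting v in N[x] = N[u], which contradicts d(u,v) = 2. So outer
-- general position sets of G are exactly the independent sets of G⁻tt.
module Submission where

open import Defs
open import Data.Nat using (ℕ; _≤_; s≤s; z≤n)
open import Data.Nat.Properties using (≤-trans)
open import Data.Fin using (Fin; _≟_)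
open import Data.Fin.Properties using (sequence)
open import Data.Fin.Subset using (Subset; _∈_; _∉_; ∣_∣)
open import Data.Fin.Subset.Properties using (_∈?_)
open import Data.Product using (Σ; _×_; _,_; proj₁; proj₂; ∃-syntax)
open import Data.Sum using (inj₁; inj₂)
open import Effect.Monad using (RawMonad)
open import Function using (const)
open import Function.Bundles using (_⇔_; mk⇔; Equivalence)
open import Function.Properties.Equivalence using () renaming (sym to ⇔-sym; trans to ⇔-trans)
open import Relation.Nullary using (¬_; yes; no; contradiction)
open import Relation.Nullary.Decidable using (¬¬-excluded-middle)
open import Relation.Nullary.Negation using (¬¬-map; ¬¬-Monad)
open import Relation.Binary.PropositionalEquality using (_≡_; _≢_; refl; sym)

¬¬-⇔ : ∀ {A B : Set} → (A → ¬ ¬ B) → (B → ¬ ¬ A) → ¬ ¬ (A ⇔ B)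
¬¬-⇔ f g ¬a⇔b = ¬¬-excluded-middle λ where
  (yes a) → f a λ b → ¬a⇔b (mk⇔ (const b) (const a))
  (no ¬a) → ¬a⇔b (mk⇔ (λ a → contradiction a ¬a) (λ b → contradiction ¬a (g b)))

¬¬-∀-Fin : ∀ {n} {P : Fin n → Set} → (∀ i → ¬ ¬ P i) → ¬ ¬ (∀ i → P i)
¬¬-∀-Fin = sequence (RawMonad.rawApplicative ¬¬-Monad)

module _ {n : ℕ} where

  HasMaxCard : (Subset n → Set) → ℕ → Set
  HasMaxCard P k = (∃[ X ] (P X × ∣ X ∣ ≡ k)) × (∀ X → P X → ∣ X ∣ ≤ k)

  hasMaxCard-cong : ∀ {P Q : Subset n → Set} {k} →
                    (∀ X → P X ⇔ Q X) → HasMaxCard P k ⇔ HasMaxCard Q k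
  hasMaxCard-cong P⇔Q = mk⇔ (transport P⇔Q) (transport (λ X → ⇔-sym (P⇔Q X)))
    where
    transport : ∀ {P Q : Subset n → Set} {k} →
                (∀ X → P X ⇔ Q X) → HasMaxCard P k → HasMaxCard Q k
    transport P⇔Q ((X , PX , ∣X∣≡k) , max) =
      (X , Equivalence.to (P⇔Q X) PX , ∣X∣≡k) ,
      (λ Y QY → max Y (Equivalence.from (P⇔Q Y) QY))

module _ {n : ℕ} (G : Graph n) where
  open Graph G

  len≤1-walk : ∀ {u v} → ClosedNbr G u v → Σ (Walk G u v) λ q → len G q ≤ 1
  len≤1-walk (inj₁ refl) = nil , z≤n
  len≤1-walk (inj₂ a)    = cons a nil , s≤s z≤n

  interior⇒2≤len : ∀ {u v x} {p : Walk G u v} → Interior G p x → 2 ≤ len G p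
  interior⇒2≤len here      = s≤s (s≤s z≤n)
  interior⇒2≤len (there i) = s≤s (≤-trans (s≤s z≤n) (interior⇒2≤len i))

  len≤2-interior : ∀ {u v x} {p : Walk G u v} →
                   len G p ≤ 2 → Interior G p x → Adj u x × Adj x v
  len≤2-interior {p = cons e (cons e′ nil)} _ here = e , e′
  len≤2-interior {p = cons _ (cons _ nil)} _ (there (there ()))
  len≤2-interior {p = cons _ (cons _ (cons _ _))} (s≤s (s≤s ())) _

  shortest⇒¬closedNbr : ∀ {u v} {p : Walk G u v} →
                        IsShortest G p → 2 ≤ len G p → ¬ ClosedNbr G u v
  shortest⇒¬closedNbr sh 2≤p uv with len≤1-walk uv
  ... | q , q≤1 with ≤-trans 2≤p (≤-trans (sh q) q≤1)
  ... | s≤s ()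

  path2-shortest : ∀ {v w x} → v ≢ x → ¬ Adj v x →
                   (e : Adj v w) (e′ : Adj w x) → IsShortest G (cons e (cons e′ nil))
  path2-shortest v≢x _ _ _ nil = contradiction refl v≢x
  path2-shortest _ ¬vx _ _ (cons e nil) = contradiction e ¬vx
  path2-shortest _ _ _ _ (cons _ (cons _ _)) = s≤s (s≤s z≤n)

  shortest-len≤ : ∀ {d u v} → (∀ u v → ∃[ k ] (Dist G u v k × k ≤ d)) →
                  {p : Walk G u v} → IsShortest G p → len G p ≤ d
  shortest-len≤ {u = u} {v} diam sh with diam u v
  ... | _ , (q , _ , refl) , q≤d = ≤-trans (sh q) q≤d

  module _ {X : Subset n} (gp : IsOuterGP G X) where

    outerGP-positionable : ∀ {u v} → u ∈ X → u ≢ v → Positionable G X u v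
    outerGP-positionable {u} {v} uX u≢v with v ∈? X
    ... | yes vX = proj₁ gp u v uX vX u≢v
    ... | no  vX = proj₂ gp u v uX vX

    outerGP-nbr : ∀ {u v x} → u ∈ X → v ∈ X → Adj u v → Adj u x → v ≢ x → ¬ ¬ Adj v x
    outerGP-nbr uX vX uv ux v≢x ¬vx =
      outerGP-positionable vX v≢x (cons (Adj-sym uv) (cons ux nil))
        (path2-shortest v≢x ¬vx (Adj-sym uv) ux) _ here uX

    outerGP-closedNbr : ∀ {u v x} → u ∈ X → v ∈ X → Adj u v →
                        ClosedNbr G u x → ¬ ¬ ClosedNbr G v x
    outerGP-closedNbr _ _ uv (inj₁ refl) = contradiction (inj₂ (Adj-sym uv))
    outerGP-closedNbr {v = v} {x} uX vX uv (inj₂ ux) with x ≟ v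
    ... | yes x≡v = contradiction (inj₁ x≡v)
    ... | no  x≢v = ¬¬-map inj₂ (outerGP-nbr uX vX uv ux (λ v≡x → x≢v (sym v≡x)))

    -- Adjacency is not decidable, so twinhood is only reached up to double
    -- negation; that suffices, since it is refuted for edges of G⁻tt.
    outerGP-adjacent-twins : ∀ {u v} → u ∈ X → v ∈ X → Adj u v → ¬ ¬ TrueTwins G u v
    outerGP-adjacent-twins {u} {v} uX vX uv = ¬¬-map (u≢v ,_) (¬¬-∀-Fin λ x →
      ¬¬-⇔ (outerGP-closedNbr uX vX uv) (outerGP-closedNbr vX uX (Adj-sym uv)))
      where
      u≢v : u ≢ v
      u≢v refl = Adj-irr uv

    outerGP⇒independent : IsIndependent (G⁻tt G) X
    outerGP⇒independent u v uX vX (uv , ¬twins) = outerGP-adjacent-twins uX vX uv ¬twins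

  module _ (diam : ∀ u v → ∃[ k ] (Dist G u v k × k ≤ 2))
           {X : Subset n} (ind : IsIndependent (G⁻tt G) X) where

    shortest-from-member : ∀ {u v} → u ∈ X → (p : Walk G u v) → IsShortest G p →
                           ∀ x → Interior G p x → x ∉ X
    shortest-from-member {u} {v} uX p sh x i xX
      with len≤2-interior (shortest-len≤ diam sh) i
    ... | ux , xv = ind u x uX xX (ux , λ (_ , N[u]⇔N[x]) →
      shortest⇒¬closedNbr sh (interior⇒2≤len i) (Equivalence.from (N[u]⇔N[x] v) (inj₂ xv)))

    independent⇒outerGP : IsOuterGP G X
    independent⇒outerGP = (λ u v uX _ _ → shortest-from-member uX) ,
                          (λ u v uX _ → shortest-from-member uX)

  outerGP⇔independent : (∀ u v → ∃[ k ] (Dist G u v k × k ≤ 2)) →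
                        ∀ X → IsOuterGP G X ⇔ IsIndependent (G⁻tt G) X
  outerGP⇔independent diam X = mk⇔ outerGP⇒independent (independent⇒outerGP diam)

  G⁻tt-independent⇔ : NoTrueTwins G → ∀ X → IsIndependent (G⁻tt G) X ⇔ IsIndependent G X
  G⁻tt-independent⇔ noTwins X = mk⇔
    (λ ind u v uX vX uv → ind u v uX vX (uv , noTwins u v))
    (λ ind u v uX vX (uv , _) → ind u v uX vX uv)

proposition3p2 : ∀ {n} (G : Graph n) → Connected G → HasDiameter G 2 →
    (∀ k → IsGpo G k ⇔ IsAlpha (G⁻tt G) k) ×
    (NoTrueTwins G → ∀ k → IsGpo G k ⇔ IsAlpha G k)
proposition3p2 G _ (diam , _) =
  (λ k → hasMaxCard-cong (outerGP⇔independent G diam)) ,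
  (λ noTwins k → hasMaxCard-cong λ X →
    ⇔-trans (outerGP⇔independent G diam X) (G⁻tt-independent⇔ G noTwins X))
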